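{- Let $\Gamma$ be a finite connected simple graph and $f_1$ an eigenfunction of its normalized Laplacian for the eigenvalue $1$. Partition the vertex set of $\Gamma$ into sets $\Sigma_0,\Sigma_1,\Sigma_2$ such that no edge of $\Gamma$ joins a vertex of $\Sigma_1$ to a vertex of $\Sigma_2$. Form a graph $\Gamma_1$ on a copy of $\Sigma_1\cup\Sigma_0$ and a graph $\Gamma_2$ on a separate (disjoint) copy of $\Sigma_2\cup\Sigma_0$, where $\Gamma_1$ contains all edges of $\Gamma$ within $\Sigma_1$ and between $\Sigma_1$ and $\Sigma_0$, $\Gamma_2$ contains all edges of $\Gamma$ within $\Sigma_2$ and between $\Sigma_2$ and $\Sigma_0$, and each edge of $\Gamma$ between two vertices of $\Sigma_0$ is placed in exactly one of $\Gamma_1,\Gamma_2$. Let $\Gamma_0$ be the graph obtained from the disjoint union of $\Gamma_1$ and $\Gamma_2$ by adding, for each $q\in\Sigma_0$, a new vertex $w_q$ joined by edges to the two copies of $q$ (in $\Gamma_1$ and in $\Gamma_2$). Then $1$ is an eigenvalue of the normalized Laplacian of $\Gamma_0$, with an eigenfunction that agrees with $f_1$ on $\Gamma_1$ (i.e. takes value $f_1(p)$ at the copy in $\Gamma_1$ of each vertex $p\in\Sigma_1\cup\Sigma_0$).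
   Context: For a finite graph without isolated vertices, with degrees $n_i$, the normalized Laplacian is $\Delta v(i)=v(i)-\frac{1}{n_i}\sum_{j\sim i}v(j)$ on real functions on the vertices; an eigenfunction for $\lambda$ is a nonzero $u$ with $\Delta u=\lambda u$. A nonzero $u$ is an eigenfunction for eigenvalue $1$ iff $\sum_{j\sim i}u(j)=0$ for every vertex $i$. -}

module Defs where

open import Level using (Level; _⊔_) renaming (suc to lsuc)
open import Data.Nat using (ℕ; zero; suc)
open import Data.Bool using (Bool; true; false; _∧_; not; T; if_then_else_)
open import Data.Fin using (Fin; _≟_)
open import Data.List using (List; []; _∷_; _++_; foldr; concatMap)
open import Data.Unit using (tt)
open import Data.Empty using (⊥)
open import Data.Product using (_×_)
open import Relation.Nullary using (¬_)
open import Relation.Nullary.Decidable using (⌊_⌋)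
open import Algebra.Bundles using (CommutativeRing)

-- Scalars: a commutative ring in which every positive integer is
-- invertible (a ℚ-algebra).  ℝ is an instance; the paper works over ℝ.

module _ {c ℓ : Level} (R : CommutativeRing c ℓ) where
  open CommutativeRing R
  ringFromℕ : ℕ → Carrier
  ringFromℕ zero    = 0#
  ringFromℕ (suc k) = 1# + ringFromℕ k

record QAlgebra (c ℓ : Level) : Set (lsuc (c ⊔ ℓ)) where
  field
    cring          : CommutativeRing c ℓ
    invSuc         : ℕ → CommutativeRing.Carrier cring
    invSuc-correct : ∀ k → CommutativeRing._≈_ cring
                       (CommutativeRing._*_ cring (ringFromℕ cring (suc k)) (invSuc k))
                       (CommutativeRing.1# cring)
  open CommutativeRing cring public
  -- 1/k for k ≥ 1 (the value at 0 is never used for graphs without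
  -- isolated vertices)
  inv : ℕ → Carrier
  inv zero    = 0#
  inv (suc k) = invSuc k

-- Finite graphs: a vertex type V, a list enumerating V (each vertex
-- exactly once), and a Boolean adjacency relation.

module Graph {V : Set} (verts : List V) (adj : V → V → Bool) where

  Simple : Set
  Simple = (∀ i j → adj i j ≡ adj j i) × (∀ i → adj i i ≡ false)
    where open import Relation.Binary.PropositionalEquality using (_≡_)

  deg : V → ℕ
  deg i = foldr (λ j acc → if adj i j then suc acc else acc) 0 verts

  NoIsolated : Set
  NoIsolated = ∀ i → ¬ (deg i ≡ 0)
    where open import Relation.Binary.PropositionalEquality using (_≡_)

  data Reach : V → V → Set where
    here : ∀ {i} → Reach i i
    step : ∀ {i j k} → T (adj i j) → Reach j k → Reach i k

  Connected : Set
  Connected = ∀ i j → Reach i j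

  module Laplacian {c ℓ} (K : QAlgebra c ℓ) where
    open QAlgebra K

    nbSum : (V → Carrier) → V → Carrier
    nbSum v i = foldr (λ j acc → if adj i j then v j + acc else acc) 0# verts

    Δ : (V → Carrier) → V → Carrier
    Δ v i = v i - inv (deg i) * nbSum v i

    IsEigenfunction : Carrier → (V → Carrier) → Set ℓ
    IsEigenfunction λ′ u = (¬ (∀ i → u i ≈ 0#)) × (∀ i → Δ u i ≈ λ′ * u i)

-- The partition Σ0, Σ1, Σ2 is given by a labelling of the vertices.

data Part : Set where
  S0 S1 S2 : Part

isS0 : Part → Bool
isS0 S0 = true
isS0 _  = false

inΓ1 : Part → Bool
inΓ1 S2 = false
inΓ1 _  = true

inΓ2 : Part → Bool
inΓ2 S1 = false
inΓ2 _  = true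

-- vertices of Γ0: copies in Γ1, copies in Γ2, and new vertices w_q
data V0 {n : ℕ} (σ : Fin n → Part) : Set where
  c1 : (i : Fin n) → T (inΓ1 (σ i)) → V0 σ
  c2 : (i : Fin n) → T (inΓ2 (σ i)) → V0 σ
  w  : (q : Fin n) → T (isS0 (σ q)) → V0 σ

private
  opt : {A : Set} (b : Bool) → (T b → A) → List A
  opt true  f = f tt ∷ []
  opt false f = []

module _ {n : ℕ} (σ : Fin n → Part) where
  open import Data.Fin using () renaming (Fin to F)
  open import Data.List using () renaming ([] to nil)

  verts0 : List (Fin n) → List (V0 σ)
  verts0 = concatMap (λ i → opt (inΓ1 (σ i)) (c1 i) ++ opt (inΓ2 (σ i)) (c2 i)
                                ++ opt (isS0 (σ i)) (w i))

  -- adjacency of Γ0, given the adjacency of Γ and the choice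
  -- side i j = true  : a Σ0–Σ0 edge {i,j} of Γ is placed in Γ1,
  -- side i j = false : it is placed in Γ2.
  adj0 : (Fin n → Fin n → Bool) → (Fin n → Fin n → Bool) → V0 σ → V0 σ → Bool
  adj0 adj side (c1 i _) (c1 j _) =
    adj i j ∧ (if isS0 (σ i) ∧ isS0 (σ j) then side i j else true)
  adj0 adj side (c2 i _) (c2 j _) =
    adj i j ∧ (if isS0 (σ i) ∧ isS0 (σ j) then not (side i j) else true)
  adj0 adj side (c1 i _) (w q _) = ⌊ i ≟ q ⌋
  adj0 adj side (w q _) (c1 i _) = ⌊ q ≟ i ⌋
  adj0 adj side (c2 i _) (w q _) = ⌊ i ≟ q ⌋
  adj0 adj side (w q _) (c2 i _) = ⌊ q ≟ i ⌋
  adj0 adj side _ _ = false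

-- Put g = f on the Γ₁-copies, g = −f on the Γ₂-copies, and let g(w_q) be minus the sum of f
-- over the Γ₁-neighbours of q.  An eigenfunction for 1 is a nonzero function whose neighbour
-- sums all vanish, so only these sums need checking.  At a copy of p ∈ Σ₁ (or Σ₂) all
-- Γ-neighbours of p lie in Γ₁ (or Γ₂), since no edge joins Σ₁ and Σ₂, so the sum is
-- ±Σ_{j∼p} f j = 0.  At the Γ₁-copy of q ∈ Σ₀ the new neighbour w_q cancels the rest by
-- construction; at the Γ₂-copy it adds the Γ₁-part to the Γ₂-part, giving −Σ_{j∼q} f j = 0
-- because every edge at q lies in exactly one of Γ₁, Γ₂.  At w_q the sum is f q − f q.

module Submission where

open import Defs
open import Data.Nat using (ℕ; zero; suc)
open import Data.Bool using (Bool; true; false; T; not; _∧_; if_then_else_)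
open import Data.Bool.Properties using (∧-identityʳ)
open import Data.Unit using (tt)
open import Data.Empty using (⊥; ⊥-elim)
open import Data.Fin using (Fin; _≟_)
open import Data.List using (List; _∷_; foldr; tabulate; allFin)
open import Data.Product using (Σ-syntax; _×_; _,_)
open import Data.Sum using (_⊎_; inj₁; inj₂)
open import Data.Vec.Functional using (Vector)
open import Function using (_∘_)
open import Relation.Nullary using (¬_)
open import Relation.Nullary.Decidable using (⌊_⌋; ⌊⌋-map′)
open import Relation.Binary.PropositionalEquality as ≡ using (_≡_)

module _ {c ℓ} (K : QAlgebra c ℓ) where
  open QAlgebra K
  open import Algebra.Properties.Ring ring using (-0#≈0#; -‿+-comm; -‿injective; +-identityʳ-unique)
  open import Algebra.Properties.Semiring.Sum semiring using (sum; sum-syntax; sum-cong-≋; sum-cong-≗; sum-replicate-zero; ∑-distrib-+)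
  open import Relation.Binary.Reasoning.Setoid setoid

  infixr 10 [_]·_

  [_]·_ : Bool → Carrier → Carrier
  [ b ]· x = if b then x else 0#

  []·-zeroʳ : ∀ b → [ b ]· 0# ≈ 0#
  []·-zeroʳ true  = refl
  []·-zeroʳ false = refl

  []·-neg : ∀ b x → [ b ]· (- x) ≈ - ([ b ]· x)
  []·-neg true  x = refl
  []·-neg false x = sym -0#≈0#

  []·-∧ : ∀ a b x → [ a ]· [ b ]· x ≡ [ a ∧ b ]· x
  []·-∧ true  b x = ≡.refl
  []·-∧ false b x = ≡.refl

  []·-comm : ∀ a b x → [ a ]· [ b ]· x ≡ [ b ]· [ a ]· x
  []·-comm true  true  x = ≡.refl
  []·-comm true  false x = ≡.refl
  []·-comm false true  x = ≡.refl
  []·-comm false false x = ≡.refl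

  ∑-zero : ∀ {m} (v : Vector Carrier m) → (∀ i → v i ≈ 0#) → sum v ≈ 0#
  ∑-zero {m} v v≈0 = trans (sum-cong-≋ v≈0) (sum-replicate-zero m)

  ∑-neg : ∀ {m} (v : Vector Carrier m) → ∑[ i < m ] (- v i) ≈ - sum v
  ∑-neg {zero}  v = sym -0#≈0#
  ∑-neg {suc m} v = trans (+-congˡ (∑-neg (v ∘ Fin.suc))) (-‿+-comm _ _)

  ∑-distrib₃ : ∀ {m} (x y z : Vector Carrier m) →
               ∑[ i < m ] (x i + (y i + z i)) ≈ sum x + (sum y + sum z)
  ∑-distrib₃ x y z = trans (∑-distrib-+ x _) (+-congˡ (∑-distrib-+ y z))

  ∑-δ : ∀ {m} (p : Fin m) (v : Vector Carrier m) → ∑[ i < m ] [ ⌊ p ≟ i ⌋ ]· v i ≈ v p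
  ∑-δ {suc m} Fin.zero    v = trans (+-congˡ (∑-zero {m} _ (λ _ → refl))) (+-identityʳ _)
  ∑-δ {suc m} (Fin.suc p) v = begin
    0# + ∑[ i < m ] [ ⌊ Fin.suc p ≟ Fin.suc i ⌋ ]· v (Fin.suc i)  ≈⟨ +-identityˡ _ ⟩
    ∑[ i < m ] [ ⌊ Fin.suc p ≟ Fin.suc i ⌋ ]· v (Fin.suc i)       ≡⟨ sum-cong-≗ (λ i → ≡.cong ([_]· v (Fin.suc i)) (⌊⌋-map′ _ _ (p ≟ i))) ⟩
    ∑[ i < m ] [ ⌊ p ≟ i ⌋ ]· v (Fin.suc i)                       ≈⟨ ∑-δ p (v ∘ Fin.suc) ⟩
    v (Fin.suc p)                                                 ∎

  ∑-mask-δ : ∀ {m} (b : Fin m → Bool) (p : Fin m) (v : Vector Carrier m) →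
             ∑[ i < m ] [ b i ]· [ ⌊ p ≟ i ⌋ ]· v i ≈ [ b p ]· v p
  ∑-mask-δ b p v = trans (reflexive (sum-cong-≗ (λ i → []·-comm (b i) _ (v i)))) (∑-δ p (λ i → [ b i ]· v i))

  -- Graph.Laplacian.nbSum u i is literally maskedSum (adj i) u verts.
  maskedSum : {A : Set} → (A → Bool) → (A → Carrier) → List A → Carrier
  maskedSum b u = foldr (λ j acc → if b j then u j + acc else acc) 0#

  maskedSum-∷ : ∀ b x r → (if b then x + r else r) ≈ [ b ]· x + r
  maskedSum-∷ true  x r = refl
  maskedSum-∷ false x r = sym (+-identityˡ r)

  maskedSum-tabulate : ∀ {A : Set} {m} (h : Fin m → A) (b : A → Bool) (u : A → Carrier) →
                       maskedSum b u (tabulate h) ≈ ∑[ k < m ] [ b (h k) ]· u (h k)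
  maskedSum-tabulate {m = zero}  h b u = refl
  maskedSum-tabulate {m = suc m} h b u =
    trans (maskedSum-∷ (b (h Fin.zero)) _ _) (+-congˡ (maskedSum-tabulate (h ∘ Fin.suc) b u))

  inv-cancel : ∀ d x → ¬ d ≡ 0 → inv d * x ≈ 0# → x ≈ 0#
  inv-cancel zero    x d≢0 _      = ⊥-elim (d≢0 ≡.refl)
  inv-cancel (suc k) x _   inv*x≈0 = begin
    x                                         ≈⟨ *-identityˡ x ⟨
    1# * x                                    ≈⟨ *-congʳ (invSuc-correct k) ⟨
    (ringFromℕ cring (suc k) * invSuc k) * x  ≈⟨ *-assoc _ _ _ ⟩
    ringFromℕ cring (suc k) * (invSuc k * x)  ≈⟨ *-congˡ inv*x≈0 ⟩
    ringFromℕ cring (suc k) * 0#              ≈⟨ zeroʳ _ ⟩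
    0#                                        ∎

  module _ {V : Set} (verts : List V) (adj : V → V → Bool) where
    open Graph verts adj
    open Laplacian K

    eigenvalue-one⇒nbSum≈0 : NoIsolated → ∀ {u} → (∀ i → Δ u i ≈ 1# * u i) → ∀ i → nbSum u i ≈ 0#
    eigenvalue-one⇒nbSum≈0 noIsolated {u} Δu≈u i =
      inv-cancel (deg i) _ (noIsolated i)
        (-‿injective (trans (+-identityʳ-unique (u i) _ (trans (Δu≈u i) (*-identityˡ (u i)))) (sym -0#≈0#)))

    nbSum≈0⇒eigenvalue-one : ∀ {u} → (∀ i → nbSum u i ≈ 0#) → ∀ i → Δ u i ≈ 1# * u i
    nbSum≈0⇒eigenvalue-one {u} nbSum≈0 i = begin
      u i - inv (deg i) * nbSum u i  ≈⟨ +-congˡ (-‿cong (trans (*-congˡ (nbSum≈0 i)) (zeroʳ _))) ⟩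
      u i - 0#                       ≈⟨ +-congˡ -0#≈0# ⟩
      u i + 0#                       ≈⟨ +-identityʳ (u i) ⟩
      u i                            ≈⟨ *-identityˡ (u i) ⟨
      1# * u i                       ∎

  -- In use, x, y, z are c1 i, c2 i, w i: the vertices of Γ₀ over a vertex i of Γ labelled s.
  overCopies : {A : Set} (s : Part) → (T (inΓ1 s) → A) → (T (inΓ2 s) → A) → (T (isS0 s) → A) →
               (A → Carrier) → Carrier
  overCopies S0 x y z m = m (x tt) + (m (y tt) + m (z tt))
  overCopies S1 x y z m = m (x tt)
  overCopies S2 x y z m = m (y tt)

  overCopies-split : ∀ {A : Set} s x y z (m : A → Carrier) {a b c} →
                     (∀ t → m (x t) ≈ a) → (∀ t → m (y t) ≈ b) → (∀ t → m (z t) ≈ c) →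
                     overCopies s x y z m ≈ [ inΓ1 s ]· a + ([ inΓ2 s ]· b + [ isS0 s ]· c)
  overCopies-split S0 x y z m ma mb mc = +-cong (ma tt) (+-cong (mb tt) (mc tt))
  overCopies-split S1 x y z m ma mb mc =
    trans (ma tt) (sym (trans (+-congˡ (+-identityˡ 0#)) (+-identityʳ _)))
  overCopies-split S2 x y z m ma mb mc =
    trans (mb tt) (sym (trans (+-identityˡ _) (+-identityʳ _)))

  module _ {n : ℕ} (σ : Fin n → Part) (b : V0 σ → Bool) (u : V0 σ → Carrier) where

    maskedSum-verts0-∷ : ∀ i L → maskedSum b u (verts0 σ (i ∷ L)) ≈
                         overCopies (σ i) (c1 i) (c2 i) (w i) (λ y → [ b y ]· u y) + maskedSum b u (verts0 σ L)
    maskedSum-verts0-∷ i L with σ i | c1 {σ = σ} i | c2 {σ = σ} i | w {σ = σ} i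
    ... | S0 | x | y | z =
      trans (maskedSum-∷ (b (x tt)) _ _)
        (trans (+-congˡ (trans (maskedSum-∷ (b (y tt)) _ _) (+-congˡ (maskedSum-∷ (b (z tt)) _ _))))
               (trans (+-congˡ (sym (+-assoc _ _ _))) (sym (+-assoc _ _ _))))
    ... | S1 | x | y | z = maskedSum-∷ (b (x tt)) _ _
    ... | S2 | x | y | z = maskedSum-∷ (b (y tt)) _ _

    maskedSum-verts0 : ∀ {m} (h : Fin m → Fin n) → maskedSum b u (verts0 σ (tabulate h)) ≈
                       ∑[ k < m ] overCopies (σ (h k)) (c1 (h k)) (c2 (h k)) (w (h k)) (λ y → [ b y ]· u y)
    maskedSum-verts0 {zero}  h = refl
    maskedSum-verts0 {suc m} h =
      trans (maskedSum-verts0-∷ (h Fin.zero) (tabulate (h ∘ Fin.suc))) (+-congˡ (maskedSum-verts0 (h ∘ Fin.suc)))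

  module Splitting {n : ℕ} (adj : Fin n → Fin n → Bool) (adj-sym : ∀ i j → adj i j ≡ adj j i)
    (σ : Fin n → Part) (separated : ∀ i j → T (adj i j) → σ i ≡ S1 → σ j ≡ S2 → ⊥)
    (side : Fin n → Fin n → Bool) (f : Fin n → Carrier)
    (f-harmonic : ∀ p → Graph.Laplacian.nbSum (allFin n) adj K f p ≈ 0#) where

    f-balanced : ∀ p → ∑[ i < n ] [ adj p i ]· f i ≈ 0#
    f-balanced p = trans (sym (maskedSum-tabulate (λ i → i) (adj p) f)) (f-harmonic p)

    -- adj₁ p i: the edge {p, i} of Γ is an edge of Γ₁ (for p a vertex of Γ₁); likewise adj₂.
    adj₁ adj₂ : Fin n → Fin n → Bool
    adj₁ p i = inΓ1 (σ i) ∧ (adj p i ∧ (if isS0 (σ p) ∧ isS0 (σ i) then side p i else true))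
    adj₂ p i = inΓ2 (σ i) ∧ (adj p i ∧ (if isS0 (σ p) ∧ isS0 (σ i) then not (side p i) else true))

    no-edge : ∀ {p i} → σ p ≡ S1 → σ i ≡ S2 → adj p i ≡ false
    no-edge {p} {i} σp≡S1 σi≡S2 with adj p i in e
    ... | true  = ⊥-elim (separated p i (≡.subst T (≡.sym e) tt) σp≡S1 σi≡S2)
    ... | false = ≡.refl

    adj₁-S1 : ∀ {p} i → σ p ≡ S1 → adj₁ p i ≡ adj p i
    adj₁-S1 {p} i σp≡S1 rewrite σp≡S1 with σ i in σi
    ... | S0 = ∧-identityʳ (adj p i)
    ... | S1 = ∧-identityʳ (adj p i)
    ... | S2 = ≡.sym (no-edge σp≡S1 σi)

    adj₂-S2 : ∀ {p} i → σ p ≡ S2 → adj₂ p i ≡ adj p i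
    adj₂-S2 {p} i σp≡S2 rewrite σp≡S2 with σ i in σi
    ... | S0 = ∧-identityʳ (adj p i)
    ... | S1 = ≡.sym (≡.trans (adj-sym p i) (no-edge σi σp≡S2))
    ... | S2 = ∧-identityʳ (adj p i)

    adj₁+adj₂-S0 : ∀ {p} i x → σ p ≡ S0 → [ adj₁ p i ]· x + [ adj₂ p i ]· x ≈ [ adj p i ]· x
    adj₁+adj₂-S0 {p} i x σp≡S0 rewrite σp≡S0 with σ i | adj p i | side p i
    ... | S0 | true  | true  = +-identityʳ x
    ... | S0 | true  | false = +-identityˡ x
    ... | S0 | false | _     = +-identityˡ 0#
    ... | S1 | true  | _     = +-identityʳ x
    ... | S1 | false | _     = +-identityˡ 0#
    ... | S2 | true  | _     = +-identityˡ x
    ... | S2 | false | _     = +-identityˡ 0#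

    N₁ N₂ : Fin n → Carrier
    N₁ p = ∑[ i < n ] [ adj₁ p i ]· f i
    N₂ p = ∑[ i < n ] [ adj₂ p i ]· f i

    N₁-S1 : ∀ {p} → σ p ≡ S1 → N₁ p ≈ 0#
    N₁-S1 {p} σp≡S1 = trans (reflexive (sum-cong-≗ (λ i → ≡.cong ([_]· f i) (adj₁-S1 i σp≡S1)))) (f-balanced p)

    N₂-S2 : ∀ {p} → σ p ≡ S2 → N₂ p ≈ 0#
    N₂-S2 {p} σp≡S2 = trans (reflexive (sum-cong-≗ (λ i → ≡.cong ([_]· f i) (adj₂-S2 i σp≡S2)))) (f-balanced p)

    N₁+N₂-S0 : ∀ {p} → σ p ≡ S0 → N₁ p + N₂ p ≈ 0#
    N₁+N₂-S0 {p} σp≡S0 =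
      trans (sym (∑-distrib-+ {n} _ _)) (trans (sum-cong-≋ (λ i → adj₁+adj₂-S0 i (f i) σp≡S0)) (f-balanced p))

    g : V0 σ → Carrier
    g (c1 i _) = f i
    g (c2 i _) = - f i
    g (w q _)  = - N₁ q

    nbSum₀ : V0 σ → Carrier
    nbSum₀ = Graph.Laplacian.nbSum (verts0 σ (allFin n)) (adj0 σ adj side) K g

    nbSum₀-split : ∀ x {a b c : Fin n → Carrier} →
                   (∀ i t → [ adj0 σ adj side x (c1 i t) ]· g (c1 i t) ≈ a i) →
                   (∀ i t → [ adj0 σ adj side x (c2 i t) ]· g (c2 i t) ≈ b i) →
                   (∀ i t → [ adj0 σ adj side x (w i t) ]· g (w i t) ≈ c i) →
                   nbSum₀ x ≈ ∑[ i < n ] [ inΓ1 (σ i) ]· a i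
                              + (∑[ i < n ] [ inΓ2 (σ i) ]· b i + ∑[ i < n ] [ isS0 (σ i) ]· c i)
    nbSum₀-split x ma mb mc =
      trans (maskedSum-verts0 σ (adj0 σ adj side x) g (λ i → i))
            (trans (sum-cong-≋ (λ i → overCopies-split (σ i) _ _ _ _ (ma i) (mb i) (mc i))) (∑-distrib₃ {n} _ _ _))

    nbSum₀-c1 : ∀ p hp → nbSum₀ (c1 p hp) ≈ N₁ p + [ isS0 (σ p) ]· (- N₁ p)
    nbSum₀-c1 p hp =
      trans (nbSum₀-split (c1 p hp) (λ _ _ → refl) (λ _ _ → refl) (λ _ _ → refl))
            (+-cong (reflexive (sum-cong-≗ (λ i → []·-∧ (inΓ1 (σ i)) _ (f i))))
                    (trans (+-congʳ (∑-zero {n} _ (λ i → []·-zeroʳ (inΓ2 (σ i)))))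
                           (trans (+-identityˡ _) (∑-mask-δ (isS0 ∘ σ) p (λ i → - N₁ i)))))

    nbSum₀-c2 : ∀ p hp → nbSum₀ (c2 p hp) ≈ - N₂ p + [ isS0 (σ p) ]· (- N₁ p)
    nbSum₀-c2 p hp =
      trans (nbSum₀-split (c2 p hp) (λ _ _ → refl) (λ _ _ → refl) (λ _ _ → refl))
            (trans (+-congʳ (∑-zero {n} _ (λ i → []·-zeroʳ (inΓ1 (σ i)))))
                   (trans (+-identityˡ _)
                          (+-cong (trans (sum-cong-≋ (λ i → trans (reflexive ([]·-∧ (inΓ2 (σ i)) _ (- f i))) ([]·-neg _ (f i))))
                                         (∑-neg {n} _))
                                  (∑-mask-δ (isS0 ∘ σ) p (λ i → - N₁ i)))))

    nbSum₀-w : ∀ q hq → nbSum₀ (w q hq) ≈ [ inΓ1 (σ q) ]· f q + ([ inΓ2 (σ q) ]· (- f q) + 0#)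
    nbSum₀-w q hq =
      trans (nbSum₀-split (w q hq) (λ _ _ → refl) (λ _ _ → refl) (λ _ _ → refl))
            (+-cong (∑-mask-δ (inΓ1 ∘ σ) q f)
                    (+-cong (∑-mask-δ (inΓ2 ∘ σ) q (λ i → - f i)) (∑-zero {n} _ (λ i → []·-zeroʳ (isS0 (σ i))))))

    c1-balanced : ∀ {p} s → σ p ≡ s → T (inΓ1 s) → N₁ p + [ isS0 s ]· (- N₁ p) ≈ 0#
    c1-balanced {p} S0 _      _ = -‿inverseʳ (N₁ p)
    c1-balanced     S1 σp≡S1 _ = trans (+-identityʳ _) (N₁-S1 σp≡S1)

    c2-balanced : ∀ {p} s → σ p ≡ s → T (inΓ2 s) → - N₂ p + [ isS0 s ]· (- N₁ p) ≈ 0#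
    c2-balanced {p} S0 σp≡S0 _ = begin
      - N₂ p + - N₁ p  ≈⟨ -‿+-comm _ _ ⟩
      - (N₂ p + N₁ p)  ≈⟨ -‿cong (+-comm _ _) ⟩
      - (N₁ p + N₂ p)  ≈⟨ -‿cong (N₁+N₂-S0 σp≡S0) ⟩
      - 0#             ≈⟨ -0#≈0# ⟩
      0#               ∎
    c2-balanced     S2 σp≡S2 _ = trans (+-identityʳ _) (trans (-‿cong (N₂-S2 σp≡S2)) -0#≈0#)

    w-balanced : ∀ s x → T (isS0 s) → [ inΓ1 s ]· x + ([ inΓ2 s ]· (- x) + 0#) ≈ 0#
    w-balanced S0 x _ = trans (+-congˡ (+-identityʳ _)) (-‿inverseʳ x)

    nbSum₀≈0 : ∀ x → nbSum₀ x ≈ 0#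
    nbSum₀≈0 (c1 p hp) = trans (nbSum₀-c1 p hp) (c1-balanced (σ p) ≡.refl hp)
    nbSum₀≈0 (c2 p hp) = trans (nbSum₀-c2 p hp) (c2-balanced (σ p) ≡.refl hp)
    nbSum₀≈0 (w q hq)  = trans (nbSum₀-w q hq) (w-balanced (σ q) (f q) hq)

    has-copy : ∀ i → T (inΓ1 (σ i)) ⊎ T (inΓ2 (σ i))
    has-copy i with σ i
    ... | S0 = inj₁ tt
    ... | S1 = inj₁ tt
    ... | S2 = inj₂ tt

    g≈0⇒f≈0 : (∀ x → g x ≈ 0#) → ∀ i → f i ≈ 0#
    g≈0⇒f≈0 g≈0 i with has-copy i
    ... | inj₁ h = g≈0 (c1 i h)
    ... | inj₂ h = -‿injective (trans (g≈0 (c2 i h)) (sym -0#≈0#))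

mainTheorem6 : ∀ {c ℓ} (K : QAlgebra c ℓ) (n : ℕ) (adj : Fin n → Fin n → Bool)
    → Graph.Simple (allFin n) adj
    → Graph.NoIsolated (allFin n) adj
    → Graph.Connected (allFin n) adj
    → (f₁ : Fin n → QAlgebra.Carrier K)
    → Graph.Laplacian.IsEigenfunction (allFin n) adj K (QAlgebra.1# K) f₁
    → (σ : Fin n → Part)
    → (∀ i j → T (adj i j) → σ i ≡ S1 → σ j ≡ S2 → ⊥)
    → (side : Fin n → Fin n → Bool)
    → (∀ i j → side i j ≡ side j i)
    → Σ[ g ∈ (V0 σ → QAlgebra.Carrier K) ]
    (Graph.Laplacian.IsEigenfunction (verts0 σ (allFin n)) (adj0 σ adj side) K (QAlgebra.1# K) g
    × (∀ p (h : T (inΓ1 (σ p))) → QAlgebra._≈_ K (g (c1 p h)) (f₁ p)))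
mainTheorem6 K n adj (adj-sym , _) noIsolated _ f (f≢0 , Δf≈f) σ separated side _ =
  g , ((λ g≈0 → f≢0 (g≈0⇒f≈0 g≈0))
      , nbSum≈0⇒eigenvalue-one K (verts0 σ (allFin n)) (adj0 σ adj side) nbSum₀≈0)
    , λ _ _ → QAlgebra.refl K
  where open Splitting K adj adj-sym σ separated side f (eigenvalue-one⇒nbSum≈0 K (allFin n) adj noIsolated Δf≈f)
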